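{- Let $M_2=K_2$ and $M_i=\mu(M_{i-1})$ for $i\geq 3$. Then $D(M_i)=D'(M_i)=2$ for every $i\geq 4$. Moreover, $D(M_3)=D'(M_3)=3$ and $D(M_2)=2$.
   Context: Graphs are finite, simple and undirected. For a graph $G$ with vertices $v_1,\dots,v_n$, the Mycielski graph $\mu(G)$ has vertex set $\{v_1,\dots,v_n,u_1,\dots,u_n,w\}$ and edge set consisting of the edges of $G$, the edges $wu_i$ for all $i$, and for every edge $v_iv_j$ of $G$ the two edges $u_iv_j$ and $v_iu_j$ (so $M_3=C_5$ and $M_4$ is the Grötzsch graph). The distinguishing number $D(H)$ is the least $r$ such that some vertex labeling of $H$ with $r$ labels is preserved only by the identity automorphism; the distinguishing index $D'(H)$ is the least $d$ such that some edge labeling of $H$ with $d$ labels is preserved only by the identity automorphism. -}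

module Defs where

open import Data.Nat using (ℕ; zero; suc; _∸_; _<_)
open import Data.Fin using (Fin)
open import Data.Fin.Properties using (_≟_)
open import Data.Bool using (Bool; true; false; not)
open import Data.Product using (Σ; _×_)
open import Relation.Nullary using (¬_)
open import Relation.Nullary.Decidable using (⌊_⌋)
open import Relation.Binary.PropositionalEquality using (_≡_)

-- A graph: a vertex type with a Boolean adjacency relation.
-- (All graphs built below are finite, simple and undirected.)
record Graph : Set₁ where
  field
    V   : Set
    adj : V → V → Bool
open Graph public

K₂ : Graph
K₂ = record { V = Fin 2 ; adj = λ x y → not ⌊ x ≟ y ⌋ }

data MV (A : Set) : Set where
  v : A → MV A
  u : A → MV A
  w : MV A

μ : Graph → Graph
μ G = record { V = MV (V G) ; adj = a }
  where
  a : MV (V G) → MV (V G) → Bool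
  a (v x) (v y) = adj G x y
  a (v x) (u y) = adj G x y
  a (u x) (v y) = adj G x y
  a (u x) (u y) = false
  a (u x) w     = true
  a w     (u y) = true
  a (v x) w     = false
  a w     (v y) = false
  a w     w     = false

-- Mshift k = M_{k+2}
Mshift : ℕ → Graph
Mshift zero    = K₂
Mshift (suc k) = μ (Mshift k)

-- M i = M_i  (only meaningful for i ≥ 2; M_2 = K₂, M_i = μ(M_{i-1}))
M : ℕ → Graph
M i = Mshift (i ∸ 2)

record Automorphism (G : Graph) : Set where
  field
    σ        : V G → V G
    σ⁻¹      : V G → V G
    inv-l    : ∀ x → σ⁻¹ (σ x) ≡ x
    inv-r    : ∀ x → σ (σ⁻¹ x) ≡ x
    preserve : ∀ x y → adj G (σ x) (σ y) ≡ adj G x y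
open Automorphism public

IsDistinguishingVertexLabeling : (G : Graph) (r : ℕ) → (V G → Fin r) → Set
IsDistinguishingVertexLabeling G r c =
  (f : Automorphism G) → (∀ x → c (σ f x) ≡ c x) → ∀ x → σ f x ≡ x

HasDistVertexLabeling : Graph → ℕ → Set
HasDistVertexLabeling G r =
  Σ (V G → Fin r) (IsDistinguishingVertexLabeling G r)

DistinguishingNumberIs : Graph → ℕ → Set
DistinguishingNumberIs G r =
  HasDistVertexLabeling G r × (∀ s → s < r → ¬ HasDistVertexLabeling G s)

-- An edge labeling with d labels: a symmetric function on pairs of vertices,
-- of which only the values on edges matter.
record EdgeLabeling (G : Graph) (d : ℕ) : Set where
  field
    lab  : V G → V G → Fin d
    symm : ∀ x y → lab x y ≡ lab y x
open EdgeLabeling public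

IsDistinguishingEdgeLabeling : (G : Graph) (d : ℕ) → EdgeLabeling G d → Set
IsDistinguishingEdgeLabeling G d ℓ =
  (f : Automorphism G) →
  (∀ x y → adj G x y ≡ true → lab ℓ (σ f x) (σ f y) ≡ lab ℓ x y) →
  ∀ x → σ f x ≡ x

HasDistEdgeLabeling : Graph → ℕ → Set
HasDistEdgeLabeling G d = Σ (EdgeLabeling G d) (IsDistinguishingEdgeLabeling G d)

DistinguishingIndexIs : Graph → ℕ → Set
DistinguishingIndexIs G d =
  HasDistEdgeLabeling G d × (∀ s → s < d → ¬ HasDistEdgeLabeling G s)

module Submission where

-- The swap of K₂ lifts to a nontrivial automorphism of every
-- M_i, so fewer than two labels never suffice.  For the 5-cycle M_3 an
-- exhaustive search shows that every 2-labeling of its vertices (resp. of its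
-- five edges) is preserved by one of its five reflections.
--
-- The core is an inductive step: if G is twin-free and
-- carries a distinguishing 2-labeling, so does μ G.  The labeling is copied
-- to the original vertices of μ G and chosen on the new vertices so that the
-- apex w is the only vertex of its kind; every automorphism then fixes w,
-- hence restricts to an automorphism of G (this is where twin-freeness is
-- used), which the old labeling forces to be the identity.  The base cases
-- (M_4, and the 3-labelings of M_3) are certified by a backtracking search
-- for label-preserving automorphisms, proved sound once and for all.

open import Defs
open import Data.Bool using (Bool; true; false; T; not; _∧_; _∨_)
import Data.Bool.Properties as Bool
open import Data.Bool.ListAction using (all; any)
open import Data.Empty using (⊥; ⊥-elim)
open import Data.Fin using (Fin; zero; suc; toℕ; opposite)
import Data.Fin.Properties as Fin
open import Data.List using (List; []; _∷_; _++_; map; allFin)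
open import Data.List.Membership.Propositional using (_∈_)
open import Data.List.Membership.Propositional.Properties
  using (∈-map⁺; ∈-++⁺ˡ; ∈-++⁺ʳ; ∈-allFin)
open import Data.List.Relation.Unary.All as All using (All; []; _∷_)
open import Data.List.Relation.Unary.All.Properties using (all⁺; all⁻)
open import Data.List.Relation.Unary.Any using (here; satisfied)
open import Data.List.Relation.Unary.Any.Properties using (any⁻)
open import Data.Nat using (ℕ; zero; suc; _+_; _∸_; _≤_; _<_; s≤s)
open import Data.Nat.DivMod using (_mod_)
open import Data.Nat.Properties using (m<1+n⇒m<n∨m≡n)
open import Data.Product using (Σ; _×_; _,_; proj₁; proj₂)
import Data.Product.Properties as Product
open import Data.Sum using (inj₁; inj₂)
open import Function using (Equivalence)
open import Relation.Binary.Definitions using (DecidableEquality)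
open import Relation.Binary.PropositionalEquality
  using (_≡_; _≢_; refl; sym; trans; cong; cong₂; subst; module ≡-Reasoning)
open import Relation.Nullary using (¬_; yes; no)
open import Relation.Nullary.Decidable using (⌊_⌋; map′; toWitness; fromWitness; toWitnessFalse)
import Algebra.Construct.NaturalChoice.Max as Max

open ≡-Reasoning

T-⇒ : ∀ {b c} → T b → T (not b ∨ c) → T c
T-⇒ {true} _ t = t

-- Introduction and elimination of a true conjunction (the first conjunct is
-- explicit: it cannot be inferred from b ∧ c).
T-∧⁺ : ∀ b {c} → T b → T c → T (b ∧ c)
T-∧⁺ true _ t = t

T-∧⁻ : ∀ b {c} → T (b ∧ c) → T b × T c
T-∧⁻ true t = _ , t

record Finite (A : Set) : Set where
  field
    elements : List A
    complete : ∀ x → x ∈ elements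
    _≟_      : DecidableEquality A

module _ {A : Set} (F : Finite A) where
  open Finite F

  everywhere : (p : A → Bool) → T (all p elements) → ∀ x → T (p x)
  everywhere p t x = All.lookup (all⁺ p elements t) (complete x)

finiteFin : ∀ n → Finite (Fin n)
finiteFin n = record { elements = allFin n ; complete = ∈-allFin ; _≟_ = Fin._≟_ }

module _ {A : Set} where
  v-injective : {x y : A} → _≡_ {A = MV A} (v x) (v y) → x ≡ y
  v-injective refl = refl

  u-injective : {x y : A} → _≡_ {A = MV A} (u x) (u y) → x ≡ y
  u-injective refl = refl

  finiteMV : Finite A → Finite (MV A)
  finiteMV F = record { elements = elements′ ; complete = complete′ ; _≟_ = _≟′_ }
    where
    open Finite F
    elements′ : List (MV A)
    elements′ = map v elements ++ map u elements ++ w ∷ []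
    complete′ : ∀ x → x ∈ elements′
    complete′ (v x) = ∈-++⁺ˡ (∈-map⁺ v (complete x))
    complete′ (u x) = ∈-++⁺ʳ (map v elements) (∈-++⁺ˡ (∈-map⁺ u (complete x)))
    complete′ w     = ∈-++⁺ʳ (map v elements) (∈-++⁺ʳ (map u elements) (here refl))
    _≟′_ : DecidableEquality (MV A)
    v x ≟′ v y = map′ (cong v) v-injective (x ≟ y)
    u x ≟′ u y = map′ (cong u) u-injective (x ≟ y)
    w   ≟′ w   = yes refl
    v _ ≟′ u _ = no λ ()
    v _ ≟′ w   = no λ ()
    u _ ≟′ v _ = no λ ()
    u _ ≟′ w   = no λ ()
    w   ≟′ v _ = no λ ()
    w   ≟′ u _ = no λ ()

finiteM : ∀ k → Finite (V (Mshift k))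
finiteM zero    = finiteFin 2
finiteM (suc k) = finiteMV (finiteM k)

module _ {G : Graph} where

  σ-injective : (f : Automorphism G) → ∀ {x y} → σ f x ≡ σ f y → x ≡ y
  σ-injective f {x} {y} e = trans (sym (inv-l f x)) (trans (cong (σ⁻¹ f) e) (inv-l f y))

  inverse : Automorphism G → Automorphism G
  inverse f = record
    { σ = σ⁻¹ f ; σ⁻¹ = σ f ; inv-l = inv-r f ; inv-r = inv-l f ; preserve = preserve⁻¹ }
    where
    preserve⁻¹ : ∀ x y → adj G (σ⁻¹ f x) (σ⁻¹ f y) ≡ adj G x y
    preserve⁻¹ x y =
      trans (sym (preserve f (σ⁻¹ f x) (σ⁻¹ f y))) (cong₂ (adj G) (inv-r f x) (inv-r f y))

mapMV : {A : Set} → (A → A) → MV A → MV A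
mapMV g (v x) = v (g x)
mapMV g (u x) = u (g x)
mapMV g w     = w

mapMV-inverse : {A : Set} {g h : A → A} → (∀ x → h (g x) ≡ x) →
                ∀ y → mapMV h (mapMV g y) ≡ y
mapMV-inverse hg (v x) = cong v (hg x)
mapMV-inverse hg (u x) = cong u (hg x)
mapMV-inverse hg w     = refl

liftAutomorphism : (G : Graph) → Automorphism G → Automorphism (μ G)
liftAutomorphism G f = record
  { σ = mapMV (σ f) ; σ⁻¹ = mapMV (σ⁻¹ f)
  ; inv-l = mapMV-inverse (inv-l f) ; inv-r = mapMV-inverse (inv-r f) ; preserve = lifted }
  where
  lifted : ∀ x y → adj (μ G) (mapMV (σ f) x) (mapMV (σ f) y) ≡ adj (μ G) x y
  lifted (v x) (v y) = preserve f x y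
  lifted (v x) (u y) = preserve f x y
  lifted (u x) (v y) = preserve f x y
  lifted (u x) (u y) = refl
  lifted (u x) w     = refl
  lifted w     (u y) = refl
  lifted (v x) w     = refl
  lifted w     (v y) = refl
  lifted w     w     = refl

module _ (G : Graph) (F : Finite (V G)) where
  open Finite F

  symmetricAt : (V G → V G) → V G → Bool
  symmetricAt s x =
    ⌊ s (s x) ≟ x ⌋ ∧ all (λ y → ⌊ adj G (s x) (s y) Bool.≟ adj G x y ⌋) elements

  isInvolutiveSymmetry : (V G → V G) → Bool
  isInvolutiveSymmetry s = all (symmetricAt s) elements

  involution : (s : V G → V G) → T (isInvolutiveSymmetry s) → Automorphism G
  involution s t = record
    { σ = s ; σ⁻¹ = s ; inv-l = involutive ; inv-r = involutive ; preserve = preserving }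
    where
    checkedAt : ∀ x → T ⌊ s (s x) ≟ x ⌋ ×
                      T (all (λ y → ⌊ adj G (s x) (s y) Bool.≟ adj G x y ⌋) elements)
    checkedAt x = T-∧⁻ ⌊ s (s x) ≟ x ⌋ (everywhere F (symmetricAt s) t x)
    involutive : ∀ x → s (s x) ≡ x
    involutive x = toWitness (proj₁ (checkedAt x))
    preserving : ∀ x y → adj G (s x) (s y) ≡ adj G x y
    preserving x y = toWitness (everywhere F _ (proj₂ (checkedAt x)) y)

fin1-unique : (a b : Fin 1) → a ≡ b
fin1-unique zero zero = refl

module _ {G : Graph} (f : Automorphism G) (x : V G) (moved : σ f x ≢ x) where

  needsTwoVertexLabels : ∀ s → s < 2 → ¬ HasDistVertexLabeling G s
  needsTwoVertexLabels zero       _ (c , _) with c x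
  ... | ()
  needsTwoVertexLabels (suc zero) _ (c , distinguishing) =
    moved (distinguishing f (λ y → fin1-unique _ _) x)
  needsTwoVertexLabels (suc (suc _)) (s≤s (s≤s ()))

  needsTwoEdgeLabels : ∀ s → s < 2 → ¬ HasDistEdgeLabeling G s
  needsTwoEdgeLabels zero       _ (ℓ , _) with lab ℓ x x
  ... | ()
  needsTwoEdgeLabels (suc zero) _ (ℓ , distinguishing) =
    moved (distinguishing f (λ y z _ → fin1-unique _ _) x)
  needsTwoEdgeLabels (suc (suc _)) (s≤s (s≤s ()))

lowerBound-suc : {H : ℕ → Set} {n : ℕ} → (∀ s → s < n → ¬ H s) → ¬ H n →
                 ∀ s → s < suc n → ¬ H s
lowerBound-suc below notN s s<1+n with m<1+n⇒m<n∨m≡n s<1+n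
... | inj₁ s<n  = below s s<n
... | inj₂ refl = notN

swapK₂ : Automorphism K₂
swapK₂ = involution K₂ (finiteFin 2) opposite _

swap : ∀ k → Automorphism (Mshift k)
swap zero    = swapK₂
swap (suc k) = liftAutomorphism (Mshift k) (swap k)

basePoint : ∀ k → V (Mshift k)
basePoint zero    = zero
basePoint (suc k) = v (basePoint k)

swap-moves : ∀ k → σ (swap k) (basePoint k) ≢ basePoint k
swap-moves zero    ()
swap-moves (suc k) e = swap-moves k (v-injective e)

-- Given a relation compatible x z y z′ ("x ↦ y and z ↦ z′ may occur together
-- in one map"), onlyIdentity enumerates all maps built point by point from
-- pairwise compatible assignments and checks that each is the identity.
module RigidityCheck {A : Set} (F : Finite A) (compatible : A → A → A → A → Bool) where
  open Finite F

  consistent : A → A → List (A × A) → Bool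
  consistent x y ps = compatible x x y y ∧ all (λ p → compatible x (proj₁ p) y (proj₂ p)) ps

  onlyIdentity : List A → List (A × A) → Bool
  onlyIdentity []       ps = all (λ p → ⌊ proj₁ p ≟ proj₂ p ⌋) ps
  onlyIdentity (x ∷ xs) ps =
    all (λ y → not (consistent x y ps) ∨ onlyIdentity xs ((x , y) ∷ ps)) elements

  rigid : Bool
  rigid = onlyIdentity elements []

  -- A map all of whose assignments are compatible is one of the enumerated
  -- maps, hence the identity.
  module _ (σ : A → A) (σ-compatible : ∀ x z → T (compatible x z (σ x) (σ z))) where

    Agrees : List (A × A) → Set
    Agrees = All (λ p → proj₂ p ≡ σ (proj₁ p))

    consistent-σ : ∀ x ps → Agrees ps → T (consistent x (σ x) ps)
    consistent-σ x ps agrees =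
      T-∧⁺ (compatible x x (σ x) (σ x)) (σ-compatible x x)
           (all⁻ _ (All.map compatible-with agrees))
      where
      compatible-with : ∀ {p} → proj₂ p ≡ σ (proj₁ p) →
                        T (compatible x (proj₁ p) (σ x) (proj₂ p))
      compatible-with {p} e =
        subst (λ y → T (compatible x (proj₁ p) (σ x) y)) (sym e) (σ-compatible x (proj₁ p))

    onlyIdentity-sound : ∀ xs ps → Agrees ps → T (onlyIdentity xs ps) →
                         All (λ x → σ x ≡ x) xs × All (λ p → σ (proj₁ p) ≡ proj₁ p) ps
    onlyIdentity-sound [] ps agrees t =
      [] , All.zipWith (λ (e , same) → trans (sym e) (sym (toWitness same))) (agrees , all⁺ _ ps t)
    onlyIdentity-sound (x ∷ xs) ps agrees t
      with onlyIdentity-sound xs ((x , σ x) ∷ ps) (refl ∷ agrees) continue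
      where
      -- the branch y = σ x of the search is the one followed by σ
      continue : T (onlyIdentity xs ((x , σ x) ∷ ps))
      continue = T-⇒ (consistent-σ x ps agrees) (All.lookup (all⁺ _ elements t) (complete (σ x)))
    ... | fixed-xs , fixed-x ∷ fixed-ps = fixed-x ∷ fixed-xs , fixed-ps

    rigid-sound : T rigid → ∀ x → σ x ≡ x
    rigid-sound t x = All.lookup (proj₁ (onlyIdentity-sound elements [] [] t)) (complete x)

module _ (G : Graph) (F : Finite (V G)) where

  sameAdjacency : V G → V G → V G → V G → Bool
  sameAdjacency x z y y′ = ⌊ adj G y y′ Bool.≟ adj G x z ⌋

  sameAdjacency-σ : (f : Automorphism G) → ∀ x z → T (sameAdjacency x z (σ f x) (σ f z))
  sameAdjacency-σ f x z = fromWitness (preserve f x z)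

  vertexRigidity : {r : ℕ} → (V G → Fin r) → Bool
  vertexRigidity c = RigidityCheck.rigid F λ x z y y′ → sameAdjacency x z y y′ ∧ ⌊ c y Fin.≟ c x ⌋

  vertexRigidity-sound : ∀ {r} (c : V G → Fin r) → T (vertexRigidity c) →
                         IsDistinguishingVertexLabeling G r c
  vertexRigidity-sound c t f preserves-c = RigidityCheck.rigid-sound F _ (σ f) compatible t
    where
    compatible : ∀ x z → T (sameAdjacency x z (σ f x) (σ f z) ∧ ⌊ c (σ f x) Fin.≟ c x ⌋)
    compatible x z =
      T-∧⁺ (sameAdjacency x z (σ f x) (σ f z)) (sameAdjacency-σ f x z) (fromWitness (preserves-c x))

  sameLabel : {d : ℕ} → EdgeLabeling G d → V G → V G → V G → V G → Bool
  sameLabel ℓ x z y y′ = not (adj G x z) ∨ ⌊ lab ℓ y y′ Fin.≟ lab ℓ x z ⌋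

  edgeRigidity : {d : ℕ} → EdgeLabeling G d → Bool
  edgeRigidity ℓ = RigidityCheck.rigid F λ x z y y′ → sameAdjacency x z y y′ ∧ sameLabel ℓ x z y y′

  edgeRigidity-sound : ∀ {d} (ℓ : EdgeLabeling G d) → T (edgeRigidity ℓ) →
                       IsDistinguishingEdgeLabeling G d ℓ
  edgeRigidity-sound ℓ t f preserves-ℓ = RigidityCheck.rigid-sound F _ (σ f) compatible t
    where
    labels : ∀ x z → T (sameLabel ℓ x z (σ f x) (σ f z))
    labels x z with adj G x z in e
    ... | false = _
    ... | true  = fromWitness (preserves-ℓ x z e)
    compatible : ∀ x z → T (sameAdjacency x z (σ f x) (σ f z) ∧ sameLabel ℓ x z (σ f x) (σ f z))
    compatible x z = T-∧⁺ (sameAdjacency x z (σ f x) (σ f z)) (sameAdjacency-σ f x z) (labels x z)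

-- Certifying that no labeling is distinguishing.  Enumerate the labelings of
-- a list of items (items not listed keep the label blank) by choosing the
-- label of each item in turn.
module LabelingSearch {I : Set} (_≟_ : DecidableEquality I) {r : ℕ} (blank : Fin r) where

  relabel : (I → Fin r) → I → Fin r → I → Fin r
  relabel g i l j with j ≟ i
  ... | yes _ = l
  ... | no  _ = g j

  relabel-agrees : ∀ g i (c : I → Fin r) j → (j ≢ i → g j ≡ c j) → relabel g i (c i) j ≡ c j
  relabel-agrees g i c j elsewhere with j ≟ i
  ... | yes refl = refl
  ... | no  j≢i  = elsewhere j≢i

  forEveryLabeling : List I → ((I → Fin r) → Bool) → Bool
  forEveryLabeling []       P = P (λ _ → blank)
  forEveryLabeling (i ∷ is) P =
    all (λ l → forEveryLabeling is (λ g → P (relabel g i l))) (allFin r)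

  forEveryLabeling-sound : ∀ is P (c : I → Fin r) → T (forEveryLabeling is P) →
                           Σ (I → Fin r) λ g → T (P g) × All (λ j → g j ≡ c j) is
  forEveryLabeling-sound []       P c t = (λ _ → blank) , t , []
  forEveryLabeling-sound (i ∷ is) P c t
    with forEveryLabeling-sound is (λ g → P (relabel g i (c i))) c
           (All.lookup (all⁺ _ (allFin r) t) (∈-allFin (c i)))
  ... | g , holds , agrees =
    relabel g i (c i) , holds ,
    relabel-agrees g i c i (λ i≢i → ⊥-elim (i≢i refl)) ∷
    All.map (λ {j} e → relabel-agrees g i c j (λ _ → e)) agrees

module InvariantLabelings {I S : Set} (_≟_ : DecidableEquality I) (items : List I)
                          (symmetries : List S) (act : S → I → I) (nontrivial : S → Bool)
                          {r : ℕ} (blank : Fin r) where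
  open import Data.List.Membership.DecPropositional _≟_ using (_∈?_)

  invariantUnder : (I → Fin r) → S → Bool
  invariantUnder g s = all (λ i → ⌊ act s i ∈? items ⌋ ∧ ⌊ g (act s i) Fin.≟ g i ⌋) items

  everyLabelingInvariant : Bool
  everyLabelingInvariant = LabelingSearch.forEveryLabeling _≟_ blank items
    (λ g → any (λ s → nontrivial s ∧ invariantUnder g s) symmetries)

  everyLabelingInvariant-sound : T everyLabelingInvariant → (c : I → Fin r) →
    Σ S λ s → T (nontrivial s) × (∀ {i} → i ∈ items → c (act s i) ≡ c i)
  everyLabelingInvariant-sound t c
    with LabelingSearch.forEveryLabeling-sound _≟_ blank items _ c t
  ... | g , found , agrees with satisfied (any⁻ _ symmetries found)
  ... | s , good with T-∧⁻ (nontrivial s) good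
  ... | nontrivial-s , invariant-g = s , nontrivial-s , invariant
    where
    -- c agrees with g on act s i, which is again one of the items
    invariant : ∀ {i} → i ∈ items → c (act s i) ≡ c i
    invariant {i} i∈
      with T-∧⁻ ⌊ act s i ∈? items ⌋ (All.lookup (all⁺ _ items invariant-g) i∈)
    ... | closed , same = begin
      c (act s i)  ≡⟨ sym (All.lookup agrees (toWitness closed)) ⟩
      g (act s i)  ≡⟨ toWitness same ⟩
      g i          ≡⟨ All.lookup agrees i∈ ⟩
      c i          ∎

module _ (G : Graph) (F : Finite (V G)) where
  open Finite F

  moves : Automorphism G → Bool
  moves f = any (λ x → not ⌊ σ f x ≟ x ⌋) elements

  moves-sound : ∀ f → T (moves f) → ¬ (∀ x → σ f x ≡ x)
  moves-sound f t fixes with satisfied (any⁻ _ elements t)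
  ... | x , moved = toWitnessFalse moved (fixes x)

  noDistinguishingVertexLabeling :
    (auts : List (Automorphism G)) {r : ℕ} (blank : Fin r) →
    T (InvariantLabelings.everyLabelingInvariant _≟_ elements auts σ moves blank) →
    ¬ HasDistVertexLabeling G r
  noDistinguishingVertexLabeling auts blank t (c , distinguishing) =
    let f , nontrivial , invariant = everyLabelingInvariant-sound t c
    in  moves-sound f nontrivial (distinguishing f (λ x → invariant (complete x)))
    where open InvariantLabelings _≟_ elements auts σ moves blank

  -- The same for edge labelings, given a list of edges, one orientation each.
  module _ (edges : List (V G × V G)) where
    _≟²_ : DecidableEquality (V G × V G)
    _≟²_ = Product.≡-dec _≟_ _≟_

    open import Data.List.Membership.DecPropositional _≟²_ using (_∈?_)

    orient : V G → V G → V G × V G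
    orient x z with (x , z) ∈? edges
    ... | yes _ = x , z
    ... | no  _ = z , x

    orient-symmetric : {B : Set} (h : V G → V G → B) → (∀ a b → h a b ≡ h b a) →
                       ∀ x z → h (proj₁ (orient x z)) (proj₂ (orient x z)) ≡ h x z
    orient-symmetric h h-symm x z with (x , z) ∈? edges
    ... | yes _ = refl
    ... | no  _ = h-symm z x

    coversEdges : Bool
    coversEdges =
      all (λ x → all (λ z → not (adj G x z) ∨ ⌊ orient x z ∈? edges ⌋) elements) elements

    actOnEdges : Automorphism G → V G × V G → V G × V G
    actOnEdges f (x , z) = orient (σ f x) (σ f z)

    noDistinguishingEdgeLabeling :
      (auts : List (Automorphism G)) {r : ℕ} (blank : Fin r) → T coversEdges →
      T (InvariantLabelings.everyLabelingInvariant _≟²_ edges auts actOnEdges moves blank) →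
      ¬ HasDistEdgeLabeling G r
    noDistinguishingEdgeLabeling auts {r} blank covers t (ℓ , distinguishing) =
      let f , nontrivial , invariant = everyLabelingInvariant-sound t labelOf
      in  moves-sound f nontrivial (distinguishing f (preserved f invariant))
      where
      open InvariantLabelings _≟²_ edges auts actOnEdges moves blank

      labelOf : V G × V G → Fin r
      labelOf e = lab ℓ (proj₁ e) (proj₂ e)

      listed : ∀ x z → adj G x z ≡ true → orient x z ∈ edges
      listed x z a = toWitness (T-⇒ (Equivalence.from Bool.T-≡ a)
                                    (everywhere F _ (everywhere F _ covers x) z))

      preserved : (f : Automorphism G) →
                  (∀ {e} → e ∈ edges → labelOf (actOnEdges f e) ≡ labelOf e) →
                  ∀ x z → adj G x z ≡ true → lab ℓ (σ f x) (σ f z) ≡ lab ℓ x z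
      preserved f invariant x z a = begin
        lab ℓ (σ f x) (σ f z)
          ≡⟨ sym (orient-symmetric (λ a b → lab ℓ (σ f a) (σ f b))
                                   (λ a b → symm ℓ (σ f a) (σ f b)) x z) ⟩
        lab ℓ (σ f (proj₁ e)) (σ f (proj₂ e))
          ≡⟨ sym (orient-symmetric (lab ℓ) (symm ℓ) (σ f (proj₁ e)) (σ f (proj₂ e))) ⟩
        labelOf (actOnEdges f e)
          ≡⟨ invariant (listed x z a) ⟩
        labelOf e
          ≡⟨ orient-symmetric (lab ℓ) (symm ℓ) x z ⟩
        lab ℓ x z ∎
        where
        e : V G × V G
        e = orient x z

NoIsolated : Graph → Set
NoIsolated G = ∀ x → Σ (V G) λ y → adj G x y ≡ true

TwinFree : Graph → Set
TwinFree G = ∀ x y → (∀ z → adj G x z ≡ adj G y z) → x ≡ y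

noIsolated-μ : (G : Graph) → V G → NoIsolated G → NoIsolated (μ G)
noIsolated-μ G p noIsolated (v x) = v (proj₁ (noIsolated x)) , proj₂ (noIsolated x)
noIsolated-μ G p noIsolated (u x) = w , refl
noIsolated-μ G p noIsolated w     = u p , refl

-- In μ G a vertex v x is told apart from u y and from w by a neighbour of x
-- in G, and u x from w by w itself.
twinFree-μ : (G : Graph) → NoIsolated G → TwinFree G → TwinFree (μ G)
twinFree-μ G noIsolated twinFree = twinFree′
  where
  separated : ∀ {b} → b ≡ true → b ≡ false → ⊥
  separated refl ()

  twinFree′ : TwinFree (μ G)
  twinFree′ (v x) (v y) same = cong v (twinFree x y (λ z → same (v z)))
  twinFree′ (u x) (u y) same = cong u (twinFree x y (λ z → same (v z)))
  twinFree′ w     w     same = refl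
  twinFree′ (v x) (u y) same =
    ⊥-elim (separated (proj₂ (noIsolated x)) (same (u (proj₁ (noIsolated x)))))
  twinFree′ (u x) (v y) same =
    ⊥-elim (separated (proj₂ (noIsolated y)) (sym (same (u (proj₁ (noIsolated y))))))
  twinFree′ (v x) w     same =
    ⊥-elim (separated (proj₂ (noIsolated x)) (same (v (proj₁ (noIsolated x)))))
  twinFree′ w     (v y) same =
    ⊥-elim (separated (proj₂ (noIsolated y)) (sym (same (v (proj₁ (noIsolated y))))))
  twinFree′ (u x) w     same = ⊥-elim (separated refl (same w))
  twinFree′ w     (u y) same = ⊥-elim (separated refl (sym (same w)))

module _ {G : Graph} where

  apex-neighbour : ∀ y → adj (μ G) w y ≡ true → Σ (V G) λ z → u z ≡ y
  apex-neighbour (u z) _ = z , refl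

  toApex : ∀ y → adj (μ G) y w ≡ true → Σ (V G) λ z → y ≡ u z
  toApex (u z) _ = z , refl

  image-apex-neighbour : (f : Automorphism (μ G)) → ∀ q → adj (μ G) (σ f w) q ≡ true →
                         Σ (V G) λ z → σ f (u z) ≡ q
  image-apex-neighbour f q a with apex-neighbour (σ⁻¹ f q) adjacent
    where
    adjacent : adj (μ G) w (σ⁻¹ f q) ≡ true
    adjacent = begin
      adj (μ G) w (σ⁻¹ f q)                 ≡⟨ sym (preserve f w (σ⁻¹ f q)) ⟩
      adj (μ G) (σ f w) (σ f (σ⁻¹ f q))     ≡⟨ cong (adj (μ G) (σ f w)) (inv-r f q) ⟩
      adj (μ G) (σ f w) q                   ≡⟨ a ⟩
      true                                  ∎
  ... | z , e = z , trans (cong (σ f) e) (inv-r f q)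

  -- An automorphism of μ G fixing w maps the original vertices among themselves.
  -- (v x is not adjacent to w, and it is not w.)
  keepsOriginal : (f : Automorphism (μ G)) → σ f w ≡ w →
                  ∀ x → Σ (V G) λ y → σ f (v x) ≡ v y
  keepsOriginal f fixes x with σ f (v x) in e
  ... | v y = y , refl
  ... | u y =
    ⊥-elim (nonadjacent (trans (cong₂ (adj (μ G)) (sym e) (sym fixes)) (preserve f (v x) w)))
    where
    nonadjacent : adj (μ G) (u y) w ≢ adj (μ G) (v x) w
    nonadjacent ()
  ... | w = ⊥-elim (v≢w (σ-injective f (trans e (sym fixes))))
    where
    v≢w : v x ≢ w
    v≢w ()

-- An automorphism f of μ G fixing w restricts to an automorphism of G
-- (acting alike on both copies when G is twin-free); f is the identity as
-- soon as the restriction is.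
module ApexFixing {G : Graph} (twinFree : TwinFree G) (f : Automorphism (μ G)) (fixes : σ f w ≡ w) where

  fixes⁻¹ : σ⁻¹ f w ≡ w
  fixes⁻¹ = trans (cong (σ⁻¹ f) (sym fixes)) (inv-l f w)

  ρ ρ⁻¹ : V G → V G
  ρ   x = proj₁ (keepsOriginal f fixes x)
  ρ⁻¹ x = proj₁ (keepsOriginal (inverse f) fixes⁻¹ x)

  onOriginal : ∀ x → σ f (v x) ≡ v (ρ x)
  onOriginal x = proj₂ (keepsOriginal f fixes x)

  onOriginal⁻¹ : ∀ x → σ⁻¹ f (v x) ≡ v (ρ⁻¹ x)
  onOriginal⁻¹ x = proj₂ (keepsOriginal (inverse f) fixes⁻¹ x)

  restriction : Automorphism G
  restriction = record
    { σ = ρ ; σ⁻¹ = ρ⁻¹ ; inv-l = ρ⁻¹ρ ; inv-r = ρρ⁻¹ ; preserve = preserving }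
    where
    ρ⁻¹ρ : ∀ x → ρ⁻¹ (ρ x) ≡ x
    ρ⁻¹ρ x = v-injective (begin
      v (ρ⁻¹ (ρ x))      ≡⟨ sym (onOriginal⁻¹ (ρ x)) ⟩
      σ⁻¹ f (v (ρ x))    ≡⟨ cong (σ⁻¹ f) (sym (onOriginal x)) ⟩
      σ⁻¹ f (σ f (v x))  ≡⟨ inv-l f (v x) ⟩
      v x                ∎)
    ρρ⁻¹ : ∀ x → ρ (ρ⁻¹ x) ≡ x
    ρρ⁻¹ x = v-injective (begin
      v (ρ (ρ⁻¹ x))      ≡⟨ sym (onOriginal (ρ⁻¹ x)) ⟩
      σ f (v (ρ⁻¹ x))    ≡⟨ cong (σ f) (sym (onOriginal⁻¹ x)) ⟩
      σ f (σ⁻¹ f (v x))  ≡⟨ inv-r f (v x) ⟩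
      v x                ∎)
    preserving : ∀ x y → adj G (ρ x) (ρ y) ≡ adj G x y
    preserving x y = trans (sym (cong₂ (adj (μ G)) (onOriginal x) (onOriginal y))) (preserve f (v x) (v y))

  -- u x is adjacent to w, so its image is some u y; y and ρ x are twins.
  onCopy : ∀ x → σ f (u x) ≡ u (ρ x)
  onCopy x with toApex (σ f (u x)) (trans (cong (adj (μ G) (σ f (u x))) (sym fixes)) (preserve f (u x) w))
  ... | y , e = trans e (cong u (twinFree y (ρ x) sameNeighbours))
    where
    preimage : ∀ z → σ f (v (ρ⁻¹ z)) ≡ v z
    preimage z = trans (onOriginal (ρ⁻¹ z)) (cong v (inv-r restriction z))
    sameNeighbours : ∀ z → adj G y z ≡ adj G (ρ x) z
    sameNeighbours z = begin
      adj (μ G) (u y) (v z)                    ≡⟨ sym (cong₂ (adj (μ G)) e (preimage z)) ⟩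
      adj (μ G) (σ f (u x)) (σ f (v (ρ⁻¹ z)))  ≡⟨ preserve f (u x) (v (ρ⁻¹ z)) ⟩
      adj G x (ρ⁻¹ z)                          ≡⟨ sym (preserve restriction x (ρ⁻¹ z)) ⟩
      adj G (ρ x) (ρ (ρ⁻¹ z))                  ≡⟨ cong (adj G (ρ x)) (inv-r restriction z) ⟩
      adj G (ρ x) z                            ∎

  identity-from-restriction : (∀ x → ρ x ≡ x) → ∀ y → σ f y ≡ y
  identity-from-restriction ρ-id (v x) = trans (onOriginal x) (cong v (ρ-id x))
  identity-from-restriction ρ-id (u x) = trans (onCopy x) (cong u (ρ-id x))
  identity-from-restriction ρ-id w     = fixes

flip : Fin 2 → Fin 2
flip zero    = suc zero
flip (suc _) = zero

flip-≢ : ∀ a → a ≢ flip a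
flip-≢ zero       ()
flip-≢ (suc zero) ()

record SpreadLabeling (G : Graph) : Set where
  field
    label          : V G → Fin 2
    avoided        : Fin 2
    distinguishing : IsDistinguishingVertexLabeling G 2 label
    otherNeighbour : ∀ x → Σ (V G) λ y → adj G x y ≡ true × label y ≢ avoided

spreadLabeling-distinguishing : {G : Graph} → SpreadLabeling G → HasDistVertexLabeling G 2
spreadLabeling-distinguishing L = SpreadLabeling.label L , SpreadLabeling.distinguishing L

otherNeighbourByCheck : (G : Graph) (F : Finite (V G)) (c : V G → Fin 2) (a : Fin 2) →
  let open Finite F in
  T (all (λ x → any (λ y → adj G x y ∧ not ⌊ c y Fin.≟ a ⌋) elements) elements) →
  ∀ x → Σ (V G) λ y → adj G x y ≡ true × c y ≢ a
otherNeighbourByCheck G F c a t x with satisfied (any⁻ _ (Finite.elements F) (everywhere F _ t x))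
... | y , found with T-∧⁻ (adj G x y) found
... | adjacent , differs = y , Equivalence.to Bool.T-≡ adjacent , toWitnessFalse differs

-- Keep the labels on the original vertices and give the label avoided to
-- all u x and to w.  Then w is the only vertex all of whose neighbours carry
-- the label avoided, so it is fixed by every label-preserving automorphism.
extendVertexLabeling : (G : Graph) → TwinFree G → V G → SpreadLabeling G → SpreadLabeling (μ G)
extendVertexLabeling G twinFree p L = record
  { label = label′ ; avoided = flip avoided
  ; distinguishing = distinguishing′ ; otherNeighbour = otherNeighbour′ }
  where
  open SpreadLabeling L

  label′ : V (μ G) → Fin 2
  label′ (v x) = label x
  label′ (u x) = avoided
  label′ w     = avoided

  otherNeighbour′ : ∀ x → Σ (V (μ G)) λ y → adj (μ G) x y ≡ true × label′ y ≢ flip avoided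
  otherNeighbour′ (v x) =
    u (proj₁ (otherNeighbour x)) , proj₁ (proj₂ (otherNeighbour x)) , flip-≢ avoided
  otherNeighbour′ (u x) = w , refl , flip-≢ avoided
  otherNeighbour′ w     = u p , refl , flip-≢ avoided

  distinguishing′ : IsDistinguishingVertexLabeling (μ G) 2 label′
  distinguishing′ f preserves = identity-from-restriction restriction-fixed
    where
    apexImage-neighbours : ∀ q → adj (μ G) (σ f w) q ≡ true → label′ q ≡ avoided
    apexImage-neighbours q a with image-apex-neighbour f q a
    ... | z , e = trans (cong label′ (sym e)) (preserves (u z))

    -- if f w were v x or u x, it would have the neighbour v y below
    notImage : ∀ x t → σ f w ≡ t → (∀ y → adj (μ G) t (v y) ≡ adj G x y) → ⊥
    notImage x t refl adjacency with otherNeighbour x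
    ... | y , xy , other = other (apexImage-neighbours (v y) (trans (adjacency y) xy))

    fixes-w : σ f w ≡ w
    fixes-w with σ f w in e
    ... | w   = refl
    ... | v x = ⊥-elim (notImage x (v x) e (λ _ → refl))
    ... | u x = ⊥-elim (notImage x (u x) e (λ _ → refl))

    open ApexFixing twinFree f fixes-w

    restriction-fixed : ∀ x → ρ x ≡ x
    restriction-fixed = distinguishing restriction
      (λ x → trans (cong label′ (sym (onOriginal x))) (preserves (v x)))

-- Keep the labels inside the original copy of G, label the edges at w by 1
-- and all others by 0.  Then w is the only vertex all of whose edges carry
-- label 1 (as G has no isolated vertices), so it is fixed.
extendEdgeLabeling : (G : Graph) → TwinFree G → NoIsolated G →
                     HasDistEdgeLabeling G 2 → HasDistEdgeLabeling (μ G) 2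
extendEdgeLabeling G twinFree noIsolated (ℓ , distinguishing) = ℓ′ , distinguishing′
  where
  L : V (μ G) → V (μ G) → Fin 2
  L (v x) (v y) = lab ℓ x y
  L (u x) w     = suc zero
  L w     (u y) = suc zero
  L _     _     = zero

  L-symm : ∀ x y → L x y ≡ L y x
  L-symm (v x) (v y) = symm ℓ x y
  L-symm (v x) (u y) = refl
  L-symm (v x) w     = refl
  L-symm (u x) (v y) = refl
  L-symm (u x) (u y) = refl
  L-symm (u x) w     = refl
  L-symm w     (v y) = refl
  L-symm w     (u y) = refl
  L-symm w     w     = refl

  ℓ′ : EdgeLabeling (μ G) 2
  ℓ′ = record { lab = L ; symm = L-symm }

  distinguishing′ : IsDistinguishingEdgeLabeling (μ G) 2 ℓ′
  distinguishing′ f preserves = identity-from-restriction restriction-fixed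
    where
    apexImage-edges : ∀ q → adj (μ G) (σ f w) q ≡ true → L (σ f w) q ≡ suc zero
    apexImage-edges q a with image-apex-neighbour f q a
    ... | z , e = trans (cong (L (σ f w)) (sym e)) (preserves w (u z) refl)

    -- if f w were v x or u x, its edge to q below would be labelled 0
    notImage : ∀ t q → σ f w ≡ t → adj (μ G) t q ≡ true → L t q ≡ zero → ⊥
    notImage t q refl a zero-label with trans (sym zero-label) (apexImage-edges q a)
    ... | ()

    fixes-w : σ f w ≡ w
    fixes-w with σ f w in e
    ... | w   = refl
    ... | v x = ⊥-elim (notImage (v x) (u (proj₁ (noIsolated x))) e (proj₂ (noIsolated x)) refl)
    ... | u x = ⊥-elim (notImage (u x) (v (proj₁ (noIsolated x))) e (proj₂ (noIsolated x)) refl)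

    open ApexFixing twinFree f fixes-w

    restriction-fixed : ∀ x → ρ x ≡ x
    restriction-fixed = distinguishing restriction
      (λ x y a → trans (sym (cong₂ L (onOriginal x) (onOriginal y))) (preserves (v x) (v y) a))

twinFree-K₂ : TwinFree K₂
twinFree-K₂ zero       zero       _    = refl
twinFree-K₂ (suc zero) (suc zero) _    = refl
twinFree-K₂ zero       (suc zero) same with same zero
... | ()
twinFree-K₂ (suc zero) zero       same with same zero
... | ()

noIsolatedM : ∀ k → NoIsolated (Mshift k)
noIsolatedM zero zero       = suc zero , refl
noIsolatedM zero (suc zero) = zero , refl
noIsolatedM (suc k)         = noIsolated-μ (Mshift k) (basePoint k) (noIsolatedM k)

twinFreeM : ∀ k → TwinFree (Mshift k)
twinFreeM zero    = twinFree-K₂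
twinFreeM (suc k) = twinFree-μ (Mshift k) (noIsolatedM k) (twinFreeM k)

symmetrised : (G : Graph) {d : ℕ} → (V G → V G → Fin d) → EdgeLabeling G d
symmetrised G {d} g =
  record { lab = λ x y → g x y ⊔ g y x ; symm = λ x y → ⊔-comm (g x y) (g y x) }
  where open Max (Fin.≤-totalOrder d)

-- M_3, the 5-cycle v₀ v₁ u₀ w u₁.
C₅ : Graph
C₅ = M 3

pentagon : Fin 5 → V C₅
pentagon zero                         = v zero
pentagon (suc zero)                   = v (suc zero)
pentagon (suc (suc zero))             = u zero
pentagon (suc (suc (suc zero)))       = w
pentagon (suc (suc (suc (suc zero)))) = u (suc zero)

position : V C₅ → Fin 5
position (v zero)       = zero
position (v (suc zero)) = suc zero
position (u zero)       = suc (suc zero)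
position w              = suc (suc (suc zero))
position (u (suc zero)) = suc (suc (suc (suc zero)))

reflection : Fin 5 → V C₅ → V C₅
reflection i x = pentagon ((toℕ i + toℕ i + 5 ∸ toℕ (position x)) mod 5)

reflections : List (Automorphism C₅)
reflections = map (λ i → involution C₅ (finiteM 1) (reflection i) (allReflections i)) (allFin 5)
  where
  allReflections : ∀ i → T (isInvolutiveSymmetry C₅ (finiteM 1) (reflection i))
  allReflections = everywhere (finiteFin 5) _ _

pentagonEdges : List (V C₅ × V C₅)
pentagonEdges = map (λ i → pentagon i , pentagon (suc (toℕ i) mod 5)) (allFin 5)

C₅-noTwoVertexLabels : ¬ HasDistVertexLabeling C₅ 2
C₅-noTwoVertexLabels = noDistinguishingVertexLabeling C₅ (finiteM 1) reflections zero _

C₅-noTwoEdgeLabels : ¬ HasDistEdgeLabeling C₅ 2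
C₅-noTwoEdgeLabels = noDistinguishingEdgeLabeling C₅ (finiteM 1) pentagonEdges reflections zero _ _

C₅-vertexLabeling : V C₅ → Fin 3
C₅-vertexLabeling (v zero)       = zero
C₅-vertexLabeling (v (suc zero)) = suc zero
C₅-vertexLabeling _              = suc (suc zero)

C₅-edgeLabeling : EdgeLabeling C₅ 3
C₅-edgeLabeling = symmetrised C₅ marks
  where
  marks : V C₅ → V C₅ → Fin 3
  marks (v zero)       (v (suc zero)) = suc (suc zero)
  marks (u (suc zero)) w              = suc zero
  marks _              _              = zero

M₄-spreadLabeling : SpreadLabeling (M 4)
M₄-spreadLabeling = record
  { label = marked ; avoided = suc zero
  ; distinguishing = vertexRigidity-sound (M 4) (finiteM 2) marked _
  ; otherNeighbour = otherNeighbourByCheck (M 4) (finiteM 2) marked (suc zero) _ }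
  where
  marked : V (M 4) → Fin 2
  marked (v w)              = suc zero
  marked (u (u (suc zero))) = suc zero
  marked _                  = zero

M₄-edgeLabeling : HasDistEdgeLabeling (M 4) 2
M₄-edgeLabeling = ℓ , edgeRigidity-sound (M 4) (finiteM 2) ℓ _
  where
  marks : V (M 4) → V (M 4) → Fin 2
  marks (u w) (v (u zero)) = suc zero
  marks _     _            = zero
  ℓ : EdgeLabeling (M 4) 2
  ℓ = symmetrised (M 4) marks

-- Distinguishing 2-labelings of M_{j+4} = Mshift (2 + j), by induction from M_4.
vertexLabelingM : ∀ j → SpreadLabeling (Mshift (2 + j))
vertexLabelingM zero    = M₄-spreadLabeling
vertexLabelingM (suc j) =
  extendVertexLabeling _ (twinFreeM (2 + j)) (basePoint (2 + j)) (vertexLabelingM j)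

edgeLabelingM : ∀ j → HasDistEdgeLabeling (Mshift (2 + j)) 2
edgeLabelingM zero    = M₄-edgeLabeling
edgeLabelingM (suc j) =
  extendEdgeLabeling _ (twinFreeM (2 + j)) (noIsolatedM (2 + j)) (edgeLabelingM j)

M-needsTwoVertexLabels : ∀ k s → s < 2 → ¬ HasDistVertexLabeling (Mshift k) s
M-needsTwoVertexLabels k = needsTwoVertexLabels (swap k) (basePoint k) (swap-moves k)

M-needsTwoEdgeLabels : ∀ k s → s < 2 → ¬ HasDistEdgeLabeling (Mshift k) s
M-needsTwoEdgeLabels k = needsTwoEdgeLabels (swap k) (basePoint k) (swap-moves k)

mainTheorem15 : ((i : ℕ) → 4 ≤ i → DistinguishingNumberIs (M i) 2 × DistinguishingIndexIs (M i) 2)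
    × (DistinguishingNumberIs (M 3) 3 × DistinguishingIndexIs (M 3) 3)
    × DistinguishingNumberIs (M 2) 2
mainTheorem15 = fromM₄ , (C₅-number , C₅-index) , K₂-number
  where
  fromM₄ : (i : ℕ) → 4 ≤ i → DistinguishingNumberIs (M i) 2 × DistinguishingIndexIs (M i) 2
  fromM₄ (suc (suc (suc (suc j)))) (s≤s (s≤s (s≤s (s≤s _)))) =
      (spreadLabeling-distinguishing (vertexLabelingM j) , M-needsTwoVertexLabels (2 + j))
    , (edgeLabelingM j , M-needsTwoEdgeLabels (2 + j))

  C₅-number : DistinguishingNumberIs C₅ 3
  C₅-number =
      (C₅-vertexLabeling , vertexRigidity-sound C₅ (finiteM 1) C₅-vertexLabeling _)
    , lowerBound-suc (M-needsTwoVertexLabels 1) C₅-noTwoVertexLabels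

  C₅-index : DistinguishingIndexIs C₅ 3
  C₅-index =
      (C₅-edgeLabeling , edgeRigidity-sound C₅ (finiteM 1) C₅-edgeLabeling _)
    , lowerBound-suc (M-needsTwoEdgeLabels 1) C₅-noTwoEdgeLabels

  K₂-number : DistinguishingNumberIs K₂ 2
  K₂-number = ((λ x → x) , (λ f preserves → preserves)) , M-needsTwoVertexLabels 0
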